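{- Consider the procedure findNewPartners described below, run on a graph $G=(V,E)$ with injective edge ranking $\pi$ and state $(P,k)$ as described. When a vertex $v$ is removed from the priority queue $S$ with priority $r_v$, every vertex that is inserted into $S$ during that same iteration of the while-loop is inserted with priority strictly greater than $r_v$.
   Context: Setting: $G=(V,E)$ is a finite undirected graph, each edge $e$ has a rank $\pi(e)\in[0,1]$, and all ranks are distinct. A matching $\mathcal{M}$ is stored via, for each vertex $x$: $P(x)$, its matched partner ($P(x)=-1$ if $x$ is unmatched), and $k(x)$, the rank of the matching edge incident to $x$ ($k(x)=\infty$ if $x$ is unmatched). $S$ is a min-priority queue of (vertex, priority) pairs. Procedure findNewPartners$(S)$: while $S$ is nonempty: remove the pair $(v,r_v)$ of lowest priority from $S$; then scan the neighbors $w$ of $v$ with $r_v<\pi(v,w)<k(v)$ in increasing order of $\pi(v,w)$; for the first such $w$ with $\pi(v,w)<k(w)$ do: if $k(w)<\infty$, let $x=P(w)$, insert $(x,k(w))$ into $S$, and set $P(x)=-1$, $k(x)=\infty$; if $k(v)<\infty$, let $x=P(v)$, insert $(x,k(v))$ into $S$, and set $P(x)=-1$, $k(x)=\infty$; then set $P(v)=w$, $P(w)=v$, $k(v)=k(w)=\pi(v,w)$ (i.e. $(v,w)$ joins the matching, replacing the previous matching edges at $v$ and $w$), and stop scanning, proceeding to the next iteration of the while-loop.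
   Formalization: The edge ranks $\pi(e)$ are rational numbers in [0,1], and the priorities in $S$ and the finite values of $k$ are rational as well. -}

module Defs where

open import Data.Nat using (ℕ)
open import Data.Fin using (Fin; _≟_)
open import Data.Maybe using (Maybe; just; nothing)
open import Data.Product using (_×_; _,_; Σ; ∃)
open import Data.Sum using (_⊎_)
open import Data.Unit using (⊤)
open import Data.Empty using (⊥)
open import Data.List using (List; []; _∷_; _++_)
open import Data.List.Relation.Unary.All using (All)
open import Data.List.Relation.Binary.Permutation.Propositional using (_↭_)
open import Data.Rational using (ℚ; _<_; _≤_; 0ℚ; 1ℚ)
open import Relation.Nullary using (¬_; yes; no)
open import Relation.Binary.PropositionalEquality using (_≡_)

-- A finite undirected graph on vertex set Fin n with an injective edge
-- ranking.  π u v ≡ just r  means {u,v} is an edge of rank r;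
-- π u v ≡ nothing means {u,v} is not an edge.
record RankedGraph : Set where
  field
    n      : ℕ
    π      : Fin n → Fin n → Maybe ℚ
    sym    : ∀ u v → π u v ≡ π v u
    noLoop : ∀ u → π u u ≡ nothing
    inRange : ∀ u v r → π u v ≡ just r → (0ℚ ≤ r) × (r ≤ 1ℚ)
    distinct : ∀ u v u' v' r → π u v ≡ just r → π u' v' ≡ just r →
               (u ≡ u' × v ≡ v') ⊎ (u ≡ v' × v ≡ u')

-- Extended ranks ℚ ∪ {∞}: nothing = ∞.
Rank∞ : Set
Rank∞ = Maybe ℚ

_<∞_ : ℚ → Rank∞ → Set
q <∞ just k  = q < k
q <∞ nothing = ⊤

-- Matching state: for each vertex x, either nothing (P(x) = -1, k(x) = ∞)
-- or just (P(x) , k(x)).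
State : ℕ → Set
State n = Fin n → Maybe (Fin n × ℚ)

module _ {n : ℕ} where

  k : State n → Fin n → Rank∞
  k M x with M x
  ... | nothing    = nothing
  ... | just (_ , r) = just r

  update : Fin n → Maybe (Fin n × ℚ) → State n → State n
  update x e M y with y ≟ x
  ... | yes _ = e
  ... | no  _ = M y

  -- "if k(y) < ∞: let x = P(y), insert (x, k(y)) into S, set P(x) = -1, k(x) = ∞"
  -- returns the inserted pairs together with the new state.
  evict : Fin n → State n → List (Fin n × ℚ) × State n
  evict y M with M y
  ... | nothing      = [] , M
  ... | just (x , r) = (x , r) ∷ [] , update x nothing M

  rematch : Fin n → Fin n → ℚ → State n → List (Fin n × ℚ) × State n
  rematch v w p M with evict w M
  ... | ins₁ , M₁ with evict v M₁
  ... | ins₂ , M₂ = ins₁ ++ ins₂ , update v (just (w , p)) (update w (just (v , p)) M₂)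

Queue : ℕ → Set
Queue n = List (Fin n × ℚ)

Config : ℕ → Set
Config n = State n × Queue n

module _ (G : RankedGraph) where
  open RankedGraph G

  Scanned : State n → Fin n → ℚ → Fin n → ℚ → Set
  Scanned M v r w p = π v w ≡ just p × r < p × p <∞ k M v

  Acceptable : State n → Fin n → ℚ → Fin n → ℚ → Set
  Acceptable M v r w p = Scanned M v r w p × p <∞ k M w

  FirstAcceptable : State n → Fin n → ℚ → Fin n → ℚ → Set
  FirstAcceptable M v r w p =
    Acceptable M v r w p × (∀ w' p' → Acceptable M v r w' p' → p ≤ p')

  -- One iteration of the while-loop of findNewPartners:
  -- Iteration C (v , r) ins C'  : from configuration C, the pair (v , r) of
  -- lowest priority is removed from S, the list ins of pairs is inserted
  -- into S during this iteration, and the resulting configuration is C'.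
  data Iteration : Config n → Fin n × ℚ → List (Fin n × ℚ) → Config n → Set where
    noPartner : ∀ {M S S' v r} →
      S ↭ ((v , r) ∷ S') →
      All (λ e → r ≤ Data.Product.proj₂ e) S' →
      (∀ w p → ¬ Acceptable M v r w p) →
      Iteration (M , S) (v , r) [] (M , S')
    partner : ∀ {M S S' v r w p} →
      S ↭ ((v , r) ∷ S') →
      All (λ e → r ≤ Data.Product.proj₂ e) S' →
      FirstAcceptable M v r w p →
      Iteration (M , S) (v , r)
        (Data.Product.proj₁ (rematch v w p M))
        (Data.Product.proj₂ (rematch v w p M) ,
         Data.Product.proj₁ (rematch v w p M) ++ S')

-- In the iteration for (v , r) the new edge (v , w) has a rank p with
-- r < p < k(v) and p < k(w).  The only pairs inserted are the old matching
-- edges at w and at v, with priorities k(w) and k(v), where k(v) is read after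
-- the edge at w was removed, which can only raise it; so both exceed r.
module Submission where

open import Defs
open import Data.Nat using (ℕ)
open import Data.Fin using (Fin; _≟_)
open import Data.Product using (_×_; _,_; proj₁; proj₂)
open import Data.List using (List; []; _∷_)
open import Data.List.Relation.Unary.All using (All; []; _∷_)
open import Data.List.Relation.Unary.All.Properties using (++⁺)
open import Data.Maybe using (just; nothing)
open import Data.Rational using (ℚ; _<_)
open import Data.Rational.Properties using (<-trans)
open import Relation.Nullary using (yes; no)

<-<∞-trans : ∀ {q p} {κ : Rank∞} → q < p → p <∞ κ → q <∞ κ
<-<∞-trans {κ = just _}  q<p p<κ = <-trans q<p p<κ
<-<∞-trans {κ = nothing} _   _   = _

module _ {n : ℕ} where

  PrioritiesAbove : ℚ → List (Fin n × ℚ) → Set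
  PrioritiesAbove q = All (λ e → q < proj₂ e)

  <∞-k-update-nothing : ∀ {q} x y (M : State n) →
                        q <∞ k M y → q <∞ k (update x nothing M) y
  <∞-k-update-nothing x y M q<ky with y ≟ x
  ... | yes _ = _
  ... | no  _ = q<ky

  <∞-k-evict : ∀ {q} w y (M : State n) →
               q <∞ k M y → q <∞ k (proj₂ (evict w M)) y
  <∞-k-evict w y M q<ky with M w
  ... | nothing      = q<ky
  ... | just (x , _) = <∞-k-update-nothing x y M q<ky

  evict-priorities : ∀ {q} y (M : State n) →
                     q <∞ k M y → PrioritiesAbove q (proj₁ (evict y M))
  evict-priorities y M q<ky with M y
  ... | nothing = []
  ... | just _  = q<ky ∷ []

  rematch-priorities : ∀ {q} v w p (M : State n) →
                       q <∞ k M v → q <∞ k M w →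
                       PrioritiesAbove q (proj₁ (rematch v w p M))
  rematch-priorities v w p M q<kv q<kw =
    ++⁺ (evict-priorities w M q<kw)
        (evict-priorities v (proj₂ (evict w M)) (<∞-k-evict w v M q<kv))

claim1 : (G : RankedGraph) → (C C' : Config (RankedGraph.n G)) →
    (v : Fin (RankedGraph.n G)) → (r : ℚ) →
    (ins : List (Fin (RankedGraph.n G) × ℚ)) →
    Iteration G C (v , r) ins C' →
    All (λ e → r < proj₂ e) ins
claim1 G _ _ v r _ (noPartner _ _ _) = []
claim1 G _ _ v r _ (partner {M = M} {w = w} {p = p} _ _ (((_ , r<p , p<kv) , p<kw) , _)) =
  rematch-priorities v w p M (<-<∞-trans r<p p<kv) (<-<∞-trans r<p p<kw)
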